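{- Let $G$ be a finite abelian group and let $A_1,\dots,A_m$ be a bimodal collection of pairwise disjoint nonempty subsets of $G$. The following are equivalent: (1) $\{A_1,\dots,A_m\}$ is an RWEDF; (2) there is a constant $\lambda$ such that $|\{i: N_i(\delta)\neq 0\}|=\lambda$ for all $\delta\in G^*$; (3) there is a constant $\mu$ such that $|\{i: N_i(\delta)=0\}|=\mu$ for all $\delta\in G^*$.
   Context: $G$ is written additively, $G^*=G\setminus\{0\}$, $k_j=|A_j|$. For $\delta\in G^*$, $N_j(\delta)=|\{(a,b): a\in A_j,\ b\in A_i \text{ for some } i\neq j,\ a-b=\delta\}|$. The collection is bimodal if $N_j(\delta)\in\{0,k_j\}$ for all $\delta\in G^*$ and all $j$. It is an RWEDF if there is a rational $\ell$ with $\sum_i \frac{1}{k_i}N_i(\delta)=\ell$ for all $\delta\in G^*$. -}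

module Defs where

open import Data.Bool using (Bool; true; false; if_then_else_; not; _∧_)
open import Data.Nat using (ℕ; zero; suc)
open import Data.Fin using (Fin)
import Data.Fin as Fin
open import Data.List using (List; map; allFin; cartesianProduct; foldr)
open import Data.Nat.ListAction using (sum)
open import Data.Bool.ListAction using (any)
open import Data.Empty using (⊥)
open import Data.List.Membership.Propositional using (_∈_)
open import Data.List.Relation.Unary.Unique.Propositional using (Unique)
open import Data.Product using (_×_; _,_; ∃)
open import Data.Sum using (_⊎_)
open import Data.Integer using (+_)
open import Data.Rational using (ℚ; _/_; 0ℚ) renaming (_+_ to _+ℚ_)
open import Algebra.Structures using (IsAbelianGroup)
open import Relation.Binary.PropositionalEquality using (_≡_; _≢_)
open import Relation.Binary.Definitions using (DecidableEquality)
open import Relation.Nullary using (¬_)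
open import Relation.Nullary.Decidable using (⌊_⌋)

record FiniteAbelianGroup : Set₁ where
  field
    Carrier  : Set
    _+_      : Carrier → Carrier → Carrier
    0#       : Carrier
    -_       : Carrier → Carrier
    isAbelianGroup : IsAbelianGroup _≡_ _+_ 0# -_
    _≟_      : DecidableEquality Carrier
    elems    : List Carrier
    complete : ∀ x → x ∈ elems
    unique   : Unique elems

  _-_ : Carrier → Carrier → Carrier
  a - b = a + (- b)

  infixl 6 _+_ _-_

count : {X : Set} → (X → Bool) → List X → ℕ
count p xs = sum (map (λ x → if p x then 1 else 0) xs)

module _ (G : FiniteAbelianGroup) where
  open FiniteAbelianGroup G

  Collection : ℕ → Set
  Collection m = Fin m → Carrier → Bool

  module _ {m : ℕ} (A : Collection m) where

    size : Fin m → ℕ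
    size j = count (A j) elems

    inOther : Fin m → Carrier → Bool
    inOther j b = any (λ i → not ⌊ i Fin.≟ j ⌋ ∧ A i b) (allFin m)

    N : Fin m → Carrier → ℕ
    N j δ = count (λ { (a , b) → A j a ∧ inOther j b ∧ ⌊ (a - b) ≟ δ ⌋ })
                  (cartesianProduct elems elems)

    PairwiseDisjoint : Set
    PairwiseDisjoint = ∀ (i j : Fin m) (g : Carrier) → i ≢ j → A i g ≡ true → A j g ≡ true → ⊥

    AllNonempty : Set
    AllNonempty = ∀ (j : Fin m) → ∃ λ g → A j g ≡ true

    Bimodal : Set
    Bimodal = ∀ (δ : Carrier) → δ ≢ 0# → ∀ (j : Fin m) → N j δ ≡ 0 ⊎ N j δ ≡ size j

    -- n / k as a rational (k = 0 never occurs for nonempty sets; mapped to 0)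
    frac : ℕ → ℕ → ℚ
    frac n zero = 0ℚ
    frac n (suc k) = (+ n) / suc k

    weightedSum : Carrier → ℚ
    weightedSum δ = foldr _+ℚ_ 0ℚ (map (λ i → frac (N i δ) (size i)) (allFin m))

    RWEDF : Set
    RWEDF = ∃ λ (ℓ : ℚ) → ∀ (δ : Carrier) → δ ≢ 0# → weightedSum δ ≡ ℓ

    ConstNonzeroCount : Set
    ConstNonzeroCount = ∃ λ (lam : ℕ) → ∀ (δ : Carrier) → δ ≢ 0# →
      count (λ i → not ⌊ N i δ Data.Nat.≟ 0 ⌋) (allFin m) ≡ lam

    ConstZeroCount : Set
    ConstZeroCount = ∃ λ (mu : ℕ) → ∀ (δ : Carrier) → δ ≢ 0# →
      count (λ i → ⌊ N i δ Data.Nat.≟ 0 ⌋) (allFin m) ≡ mu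

module Submission where

-- Bimodality says N_i(δ) ∈ {0, k_i}, so each summand N_i(δ)/k_i of
-- the weighted sum is 1 when N_i(δ) ≠ 0 and 0 otherwise.  Hence the
-- weighted sum at δ is the natural number λ(δ) = |{i : N_i(δ) ≠ 0}|
-- viewed as a rational, and since ℕ → ℚ is injective the weighted sum is
-- constant on G* exactly when λ is.  Finally μ(δ) = m - λ(δ), so λ is
-- constant exactly when μ is.

open import Defs
open import Data.Nat as ℕ using (ℕ; zero; suc; _+_; _∸_; _<′_; ≤′-refl; ≤′-step)
open import Data.Product using (_×_; _,_; ∃)
open import Function.Bundles using (_⇔_; mk⇔)

import Data.Nat.Properties as ℕP
import Data.Integer.Properties as ℤP
open import Data.Integer using (+_)
open import Data.Rational using (ℚ; 0ℚ; 1ℚ; _<_; _/_) renaming (_+_ to _+ℚ_)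
open import Data.Rational.Properties using (+-identityˡ; +-monoˡ-<; <-trans; <-irrefl; 0/n≡0; fromℚᵘ-cong; positive⁻¹)
import Data.Rational.Unnormalised as ℚᵘ
open import Data.Fin using (Fin)
open import Data.Bool using (Bool; true; false; if_then_else_; not)
open import Data.List using (List; []; _∷_; map; foldr; length; allFin)
import Data.List.Relation.Unary.Any as Any
open import Data.Sum using (_⊎_; inj₁; inj₂)
open import Data.Empty using (⊥-elim)
open import Function using (_∘_)
import Function.Properties.Equivalence as ⇔
open import Relation.Binary using (tri<; tri≈; tri>)
open import Relation.Binary.PropositionalEquality
open import Relation.Nullary using (¬_; yes; no; ¬?)
open import Relation.Nullary.Decidable using (⌊_⌋)

-- h is constant on the points satisfying P.  All three conditions of the
-- theorem are instances of this with P δ = (δ ≠ 0).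
ConstantOn : {D B : Set} → (D → Set) → (D → B) → Set
ConstantOn {B = B} P h = ∃ λ (b : B) → ∀ δ → P δ → h δ ≡ b

-- Extracting the constant of c from that of w needs a point of P (or the
-- knowledge that P is empty, where any value will do).
constantOn-injection : {D A B : Set} (P : D → Set) (a₀ : A) →
  (∃ P) ⊎ (∀ δ → ¬ P δ) →
  (e : A → B) → (∀ {x y} → e x ≡ e y → x ≡ y) →
  (w : D → B) (c : D → A) → (∀ δ → P δ → w δ ≡ e (c δ)) →
  ConstantOn P w ⇔ ConstantOn P c
constantOn-injection P a₀ inhabited e e-inj w c w≡ec = mk⇔ to from
  where
  to : ConstantOn P w → ConstantOn P c
  to (b , w≡b) = constant inhabited
    where
    constant : (∃ P) ⊎ (∀ δ → ¬ P δ) → ConstantOn P c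
    constant (inj₁ (δ₀ , Pδ₀)) = c δ₀ , λ δ Pδ → e-inj (begin
      e (c δ)   ≡⟨ sym (w≡ec δ Pδ) ⟩
      w δ       ≡⟨ trans (w≡b δ Pδ) (sym (w≡b δ₀ Pδ₀)) ⟩
      w δ₀      ≡⟨ w≡ec δ₀ Pδ₀ ⟩
      e (c δ₀)  ∎)
      where open ≡-Reasoning
    constant (inj₂ empty) = a₀ , λ δ Pδ → ⊥-elim (empty δ Pδ)

  from : ConstantOn P c → ConstantOn P w
  from (a , c≡a) = e a , λ δ Pδ → trans (w≡ec δ Pδ) (cong e (c≡a δ Pδ))

count-split : {X : Set} (f : X → Bool) (xs : List X) →
  count f xs + count (not ∘ f) xs ≡ length xs
count-split f [] = refl
count-split f (x ∷ xs) with f x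
... | true  = cong suc (count-split f xs)
... | false = trans (ℕP.+-suc _ _) (cong suc (count-split f xs))

constantOn-complementary : {D : Set} (P : D → Set) (u v : D → ℕ) (n : ℕ) →
  (∀ δ → u δ + v δ ≡ n) → ConstantOn P u → ConstantOn P v
constantOn-complementary P u v n u+v≡n (a , u≡a) = n ∸ a , λ δ Pδ → begin
  v δ              ≡⟨ sym (ℕP.m+n∸m≡n (u δ) (v δ)) ⟩
  u δ + v δ ∸ u δ  ≡⟨ cong₂ _∸_ (u+v≡n δ) (u≡a δ Pδ) ⟩
  n ∸ a            ∎
  where open ≡-Reasoning

constantOn-complement : {D X : Set} (P : D → Set) (f : D → X → Bool) (xs : List X) →
  ConstantOn P (λ δ → count (f δ) xs) ⇔ ConstantOn P (λ δ → count (not ∘ f δ) xs)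
constantOn-complement {D} P f xs = mk⇔
  (constantOn-complementary P countF countNotF (length xs) split)
  (constantOn-complementary P countNotF countF (length xs)
    (λ δ → trans (ℕP.+-comm (countNotF δ) (countF δ)) (split δ)))
  where
  countF countNotF : D → ℕ
  countF    δ = count (f δ) xs
  countNotF δ = count (not ∘ f δ) xs

  split : ∀ δ → countF δ + countNotF δ ≡ length xs
  split δ = count-split (f δ) xs

-- The rational n = 1 + ... + 1, the image of n under ℕ → ℚ.
ones : ℕ → ℚ
ones zero    = 0ℚ
ones (suc n) = 1ℚ +ℚ ones n

ones-step : ∀ n → ones n < ones (suc n)
ones-step n = subst (_< ones (suc n)) (+-identityˡ (ones n))
                    (+-monoˡ-< (ones n) (positive⁻¹ 1ℚ))

ones-strictMono : ∀ {a b} → a <′ b → ones a < ones b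
ones-strictMono {a} ≤′-refl        = ones-step a
ones-strictMono {b = suc b} (≤′-step a<′b) = <-trans (ones-strictMono a<′b) (ones-step b)

ones-injective : ∀ {a b} → ones a ≡ ones b → a ≡ b
ones-injective {a} {b} eq with ℕP.<-cmp a b
... | tri< a<b _ _ = ⊥-elim (<-irrefl eq (ones-strictMono (ℕP.<⇒<′ a<b)))
... | tri≈ _ a≡b _ = a≡b
... | tri> _ _ b<a = ⊥-elim (<-irrefl (sym eq) (ones-strictMono (ℕP.<⇒<′ b<a)))

indicator : Bool → ℚ
indicator b = if b then 1ℚ else 0ℚ

sum-indicators : {X : Set} (g : X → ℚ) (f : X → Bool) (xs : List X) →
  (∀ x → g x ≡ indicator (f x)) →
  foldr _+ℚ_ 0ℚ (map g xs) ≡ ones (count f xs)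
sum-indicators g f [] g≡ = refl
sum-indicators g f (x ∷ xs) g≡ with f x | g≡ x
... | true  | gx≡1 = cong₂ _+ℚ_ gx≡1 (sum-indicators g f xs g≡)
... | false | gx≡0 = trans (cong₂ _+ℚ_ gx≡0 (sum-indicators g f xs g≡)) (+-identityˡ _)

-- n/n = 1 in ℚ, read off from the unnormalised fraction n/n ≃ 1/1.
n/n≡1 : ∀ k → + suc k / suc k ≡ 1ℚ
n/n≡1 k = fromℚᵘ-cong {ℚᵘ.mkℚᵘ (+ suc k) k} {ℚᵘ.mkℚᵘ (+ 1) 0}
  (ℚᵘ.*≡* (trans (ℤP.*-identityʳ (+ suc k)) (sym (ℤP.*-identityˡ (+ suc k)))))

module _ (G : FiniteAbelianGroup) where
  open FiniteAbelianGroup G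

  nonzero-inhabited? : (∃ λ δ → δ ≢ 0#) ⊎ (∀ δ → ¬ δ ≢ 0#)
  nonzero-inhabited? with Any.any? (λ x → ¬? (x ≟ 0#)) elems
  ... | yes found = inj₁ (Any.satisfied found)
  ... | no none   = inj₂ (λ δ δ≢0 → none (Any.map (λ { refl → δ≢0 }) (complete δ)))

  module _ {m : ℕ} (A : Collection G m) where

    occurs : Carrier → Fin m → Bool
    occurs δ i = not ⌊ N G A i δ ℕ.≟ 0 ⌋

    frac-bimodal : ∀ n k → n ≡ 0 ⊎ n ≡ k → frac G A n k ≡ indicator (not ⌊ n ℕ.≟ 0 ⌋)
    frac-bimodal zero    zero    _           = refl
    frac-bimodal zero    (suc k) _           = 0/n≡0 (suc k)
    frac-bimodal (suc n) _       (inj₁ ())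
    frac-bimodal (suc n) _       (inj₂ refl) = n/n≡1 n

    weightedSum-counts : Bimodal G A → ∀ δ → δ ≢ 0# →
      weightedSum G A δ ≡ ones (count (occurs δ) (allFin m))
    weightedSum-counts bimodal δ δ≢0 =
      sum-indicators _ (occurs δ) (allFin m) (λ i → frac-bimodal _ _ (bimodal δ δ≢0 i))

mainTheorem13 : (G : FiniteAbelianGroup) (m : ℕ) (A : Collection G m) →
    PairwiseDisjoint G A → AllNonempty G A → Bimodal G A →
    (RWEDF G A ⇔ ConstNonzeroCount G A) × (RWEDF G A ⇔ ConstZeroCount G A)
mainTheorem13 G m A _ _ bimodal =
  rwedf⇔nonzeroCount , ⇔.trans rwedf⇔nonzeroCount (⇔.sym zeroCount⇔nonzeroCount)
  where
  open FiniteAbelianGroup G using (0#)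

  -- (1) ⇔ (2): the weighted sum is λ(δ) read in ℚ.
  rwedf⇔nonzeroCount : RWEDF G A ⇔ ConstNonzeroCount G A
  rwedf⇔nonzeroCount =
    constantOn-injection (_≢ 0#) 0 (nonzero-inhabited? G) ones ones-injective
      (weightedSum G A) (λ δ → count (occurs G A δ) (allFin m))
      (weightedSum-counts G A bimodal)

  -- (3) ⇔ (2): μ(δ) and λ(δ) are complementary counts.
  zeroCount⇔nonzeroCount : ConstZeroCount G A ⇔ ConstNonzeroCount G A
  zeroCount⇔nonzeroCount =
    constantOn-complement (_≢ 0#) (λ δ i → ⌊ N G A i δ ℕ.≟ 0 ⌋) (allFin m)
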